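{- Let $f:\{0,1\}^n\to\{0,1\}$ be a linear threshold function that depends on all $n$ of its input bits. Then $s(f)\ge\lceil(n+1)/2\rceil$. Moreover this bound is best possible: the Majority function on $n$ bits is such a function with $s(f)=\lceil(n+1)/2\rceil$.
   Context: $f$ is a linear threshold function if there are real weights $w_1,\dots,w_n$ and a threshold $\theta$ with $f(x)=1$ iff $\sum_i w_ix_i>\theta$ (and $f(x)=0$ otherwise). $f$ depends on bit $i$ if there is $x$ with $f(x)\ne f(x\oplus e_i)$. The sensitivity $s(f)$ is the maximum over $x$ of the number of Hamming neighbours $y$ of $x$ with $f(y)\ne f(x)$. Majority on $n$ bits is $f(x)=1$ iff $|x|>n/2$.
   Formalization: The weights $w_i$ and the threshold θ of a linear threshold function are taken in ℚ rather than in the reals. -}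

module Defs where

open import Data.Bool using (Bool; true; false; not; if_then_else_)
open import Data.Nat using (ℕ; zero; suc; _+_; _*_; _⊔_; _<ᵇ_)
open import Data.Fin using (Fin)
open import Data.Vec using (Vec; []; _∷_; updateAt)
open import Data.List using (List; []; _∷_; _++_; map; foldr; allFin)
open import Data.Nat.ListAction using (sum)
open import Data.Rational using (ℚ; 0ℚ) renaming (_+_ to _+ℚ_; _<_ to _<ℚ_)
open import Data.Product using (Σ; _×_)
open import Relation.Binary.PropositionalEquality using (_≡_; _≢_)

-- Boolean functions on n bits ({0,1} encoded as Bool, true = 1)
BoolFun : ℕ → Set
BoolFun n = Vec Bool n → Bool

dot : ∀ {n} → Vec ℚ n → Vec Bool n → ℚ
dot []       []       = 0ℚ
dot (w ∷ ws) (b ∷ bs) = (if b then w else 0ℚ) +ℚ dot ws bs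

IsLTF : ∀ {n} → BoolFun n → Set
IsLTF {n} f = Σ (Vec ℚ n) λ w → Σ ℚ λ θ →
  ∀ x → (f x ≡ true → θ <ℚ dot w x) × (θ <ℚ dot w x → f x ≡ true)

flipBit : ∀ {n} → Fin n → Vec Bool n → Vec Bool n
flipBit i x = updateAt x i not

DependsOn : ∀ {n} → BoolFun n → Fin n → Set
DependsOn {n} f i = Σ (Vec Bool n) λ x → f x ≢ f (flipBit i x)

DependsOnAll : ∀ {n} → BoolFun n → Set
DependsOnAll {n} f = (i : Fin n) → DependsOn f i

allInputs : (n : ℕ) → List (Vec Bool n)
allInputs zero    = [] ∷ []
allInputs (suc n) = map (true ∷_) (allInputs n) ++ map (false ∷_) (allInputs n)

sensAt : ∀ {n} → BoolFun n → Vec Bool n → ℕ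
sensAt {n} f x = sum (map (λ i → if differs i then 1 else 0) (allFin n))
  where
  differs : Fin n → Bool
  differs i with f x | f (flipBit i x)
  ... | true  | false = true
  ... | false | true  = true
  ... | _     | _     = false

sensitivity : ∀ {n} → BoolFun n → ℕ
sensitivity {n} f = foldr (λ x m → sensAt f x ⊔ m) 0 (allInputs n)

weight : ∀ {n} → Vec Bool n → ℕ
weight []           = 0
weight (true ∷ xs)  = suc (weight xs)
weight (false ∷ xs) = weight xs

majority : (n : ℕ) → BoolFun n
majority n x = n <ᵇ 2 * weight x

{-# OPTIONS --safe #-}
-- Let i be a bit of least absolute weight and x, x′ = x ⊕ eᵢ an edge with f x = 0, f x′ = 1.
-- Flipping any bit j moves Σ wₖxₖ by ±wⱼ, at least as far as flipping i does: moving up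
-- from x crosses the threshold, moving down from x′ crosses it back.  So every bit is
-- sensitive at x or at x′, bit i at both, giving s(x) + s(x′) ≥ n + 1.
-- Majority is sensitive only at weight ⌊n/2⌋ (to its ⌈n/2⌉ zeros) and at weight
-- ⌊n/2⌋ + 1 (to its ones), so s(Maj) ≤ ⌊n/2⌋ + 1 = ⌈(n+1)/2⌉.
module Submission where

open import Defs
open import Data.Bool using (Bool; true; false; not; if_then_else_; _xor_)
open import Data.Bool.Properties using (not-involutive; T-≡)
open import Data.Nat using (ℕ; zero; suc; _+_; _∸_; _≤_; _<_; _⊔_; _<ᵇ_; z≤n; s≤s; s≤s⁻¹; ⌈_/2⌉; ⌊_/2⌋)
import Data.Nat.Properties as ℕ
open import Data.Nat.ListAction using () renaming (sum to sumᴸ)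
open import Data.Fin using (Fin; zero; suc; _≟_)
open import Data.Vec using (Vec; []; _∷_; lookup; insertAt; replicate)
open import Data.Vec.Properties using (lookup∘updateAt′; updateAt-updateAt-local; updateAt-id; insertAt-lookup)
open import Data.List using (List; []; _∷_; map; allFin; tabulate; foldr)
open import Data.List.Properties using (map-tabulate)
open import Data.List.Membership.Propositional using (_∈_)
open import Data.List.Membership.Propositional.Properties using (∈-map⁺; ∈-++⁺ˡ; ∈-++⁺ʳ; ∈-allFin)
open import Data.List.Relation.Unary.Any using (here; there)
import Data.List.Relation.Unary.All as All
open import Data.Rational using (ℚ; mkℚ; 0ℚ; 1ℚ; ∣_∣; -_)
  renaming (_+_ to _+ℚ_; _<_ to _<ℚ_; _≤_ to _≤ℚ_)
import Data.Rational.Properties as ℚ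
open import Data.Rational.Solver using (module +-*-Solver)
import Data.Integer as ℤ
open import Data.Product using (_×_; _,_; proj₁; proj₂)
open import Data.Sum using (_⊎_; inj₁; inj₂)
open import Function using (id; _∘_; Equivalence)
open import Relation.Binary.Bundles using (DecTotalOrder)
open import Relation.Nullary using (yes; no; contradiction)
open import Relation.Binary.PropositionalEquality
open import Algebra.Properties.CommutativeMonoid.Sum ℕ.+-0-commutativeMonoid
  using (sum; sum-syntax; ∑-distrib-+; sum-cong-≗)
open import Data.List.Extrema (DecTotalOrder.totalOrder ℚ.≤-decTotalOrder)
  using (argmin; f[argmin]≤f[xs])

private
  variable
    n : ℕ

∑-mono-≤ : {f g : Fin n → ℕ} → (∀ j → f j ≤ g j) → sum f ≤ sum g
∑-mono-≤ {zero}  _   = z≤n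
∑-mono-≤ {suc n} f≤g = ℕ.+-mono-≤ (f≤g zero) (∑-mono-≤ (f≤g ∘ suc))

n≤∑ : (f : Fin n → ℕ) → (∀ j → 1 ≤ f j) → n ≤ sum f
n≤∑ {zero}  f 1≤f = z≤n
n≤∑ {suc n} f 1≤f = ℕ.+-mono-≤ (1≤f zero) (n≤∑ (f ∘ suc) (1≤f ∘ suc))

n<∑ : (f : Fin n → ℕ) (i : Fin n) → (∀ j → 1 ≤ f j) → 2 ≤ f i → n < sum f
n<∑ {suc n} f zero    1≤f 2≤fi = ℕ.+-mono-≤ 2≤fi (n≤∑ (f ∘ suc) (1≤f ∘ suc))
n<∑ {suc n} f (suc i) 1≤f 2≤fi = ℕ.+-mono-≤ (1≤f zero) (n<∑ (f ∘ suc) i (1≤f ∘ suc) 2≤fi)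

sumᴸ-tabulate : (f : Fin n → ℕ) → sumᴸ (tabulate f) ≡ sum f
sumᴸ-tabulate {zero}  f = refl
sumᴸ-tabulate {suc n} f = cong (f zero +_) (sumᴸ-tabulate (f ∘ suc))

∑-ones : (x : Vec Bool n) → ∑[ j < n ] (if lookup x j then 1 else 0) ≡ weight x
∑-ones []          = refl
∑-ones (true ∷ x)  = cong suc (∑-ones x)
∑-ones (false ∷ x) = ∑-ones x

∑-zeros+weight : (x : Vec Bool n) → ∑[ j < n ] (if not (lookup x j) then 1 else 0) + weight x ≡ n
∑-zeros+weight []          = refl
∑-zeros+weight (true ∷ x)  = trans (ℕ.+-suc _ (weight x)) (cong suc (∑-zeros+weight x))
∑-zeros+weight (false ∷ x) = cong suc (∑-zeros+weight x)

∑-zeros : (x : Vec Bool n) → ∑[ j < n ] (if not (lookup x j) then 1 else 0) ≡ n ∸ weight x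
∑-zeros x = trans (sym (ℕ.m+n∸n≡m _ (weight x))) (cong (_∸ weight x) (∑-zeros+weight x))

sensitiveAt : BoolFun n → Vec Bool n → Fin n → ℕ
sensitiveAt f x j = if f x xor f (flipBit j x) then 1 else 0

sensAt≡∑sensitiveAt : (f : BoolFun n) (x : Vec Bool n) → sensAt f x ≡ ∑[ j < n ] sensitiveAt f x j
sensAt≡∑sensitiveAt {n} f x = begin
  sensAt f x                   ≡⟨ sensAt-unfolded ⟩
  sumᴸ (map summand (allFin n)) ≡⟨ cong sumᴸ (map-tabulate id summand) ⟩
  sumᴸ (tabulate summand)       ≡⟨ sumᴸ-tabulate summand ⟩
  sum summand                   ≡⟨ sum-cong-≗ summand≗sensitiveAt ⟩
  sum (sensitiveAt f x)         ∎
  where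
  open ≡-Reasoning
  -- The summand of sensAt is local to Defs; sensAt-unfolded names it by unification.
  summand : Fin n → ℕ
  summand = _
  sensAt-unfolded : sensAt f x ≡ sumᴸ (map summand (allFin n))
  sensAt-unfolded = refl
  summand≗sensitiveAt : ∀ j → summand j ≡ sensitiveAt f x j
  summand≗sensitiveAt j with f x | f (flipBit j x)
  ... | true  | true  = refl
  ... | true  | false = refl
  ... | false | true  = refl
  ... | false | false = refl

sensAt-cong : {f g : BoolFun n} → (∀ y → f y ≡ g y) → ∀ x → sensAt f x ≡ sensAt g x
sensAt-cong {f = f} {g} f≗g x = begin
  sensAt f x              ≡⟨ sensAt≡∑sensitiveAt f x ⟩
  sum (sensitiveAt f x)   ≡⟨ sum-cong-≗ (λ j → cong₂ (λ a b → if a xor b then 1 else 0) (f≗g x) (f≗g (flipBit j x))) ⟩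
  sum (sensitiveAt g x)   ≡⟨ sensAt≡∑sensitiveAt g x ⟨
  sensAt g x              ∎
  where open ≡-Reasoning

1≤sensitiveAt : (f : BoolFun n) {x : Vec Bool n} {j : Fin n} → f x ≢ f (flipBit j x) → 1 ≤ sensitiveAt f x j
1≤sensitiveAt f {x} {j} differs with f x | f (flipBit j x)
... | true  | true  = contradiction refl differs
... | true  | false = ℕ.≤-refl
... | false | true  = ℕ.≤-refl
... | false | false = contradiction refl differs

sensitiveAt≤if : (f : BoolFun n) {x : Vec Bool n} {j : Fin n} (b : Bool) →
                 (f x ≢ f (flipBit j x) → b ≡ true) → sensitiveAt f x j ≤ (if b then 1 else 0)
sensitiveAt≤if f {x} {j} b only-if-b with f x | f (flipBit j x)
... | true  | true  = z≤n
... | false | false = z≤n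
... | true  | false rewrite only-if-b (λ ()) = ℕ.≤-refl
... | false | true  rewrite only-if-b (λ ()) = ℕ.≤-refl

≤-foldr-⊔ : {A : Set} (g : A → ℕ) (e : ℕ) {x : A} {xs : List A} → x ∈ xs → g x ≤ foldr (λ y m → g y ⊔ m) e xs
≤-foldr-⊔ g e {x} (here refl) = ℕ.m≤m⊔n (g x) _
≤-foldr-⊔ g e {xs = y ∷ _} (there x∈xs) = ℕ.≤-trans (≤-foldr-⊔ g e x∈xs) (ℕ.m≤n⊔m (g y) _)

foldr-⊔-≤ : {A : Set} (g : A → ℕ) {e b : ℕ} (xs : List A) → e ≤ b → (∀ y → g y ≤ b) → foldr (λ y m → g y ⊔ m) e xs ≤ b
foldr-⊔-≤ g []       e≤b g≤b = e≤b
foldr-⊔-≤ g (y ∷ xs) e≤b g≤b = ℕ.⊔-lub (g≤b y) (foldr-⊔-≤ g xs e≤b g≤b)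

∈-allInputs : (x : Vec Bool n) → x ∈ allInputs n
∈-allInputs []                  = here refl
∈-allInputs {suc n} (true ∷ x)  = ∈-++⁺ˡ (∈-map⁺ (true ∷_) (∈-allInputs x))
∈-allInputs {suc n} (false ∷ x) = ∈-++⁺ʳ (map (true ∷_) (allInputs n)) (∈-map⁺ (false ∷_) (∈-allInputs x))

sensAt≤sensitivity : (f : BoolFun n) (x : Vec Bool n) → sensAt f x ≤ sensitivity f
sensAt≤sensitivity f x = ≤-foldr-⊔ (sensAt f) 0 (∈-allInputs x)

sensitivity≤ : (f : BoolFun n) {b : ℕ} → (∀ x → sensAt f x ≤ b) → sensitivity f ≤ b
sensitivity≤ {n} f = foldr-⊔-≤ (sensAt f) (allInputs n) z≤n

⌈/2⌉≤sensitivity : (f : BoolFun n) {m : ℕ} (x y : Vec Bool n) →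
                   m ≤ sensAt f x + sensAt f y → ⌈ m /2⌉ ≤ sensitivity f
⌈/2⌉≤sensitivity f {m} x y m≤sx+sy = ℕ.≤-trans (ℕ.⌈n/2⌉-mono m≤2s) (ℕ.≤-reflexive (sym (ℕ.n≡⌈n+n/2⌉ s)))
  where
  s = sensitivity f
  m≤2s : m ≤ s + s
  m≤2s = ℕ.≤-trans m≤sx+sy (ℕ.+-mono-≤ (sensAt≤sensitivity f x) (sensAt≤sensitivity f y))

flipBit-involutive : (i : Fin n) (x : Vec Bool n) → flipBit i (flipBit i x) ≡ x
flipBit-involutive i x = trans (updateAt-updateAt-local i x (not-involutive _)) (updateAt-id i x)

shift : Vec ℚ n → Vec Bool n → Fin n → ℚ
shift w x j = if lookup x j then - lookup w j else lookup w j

dot-flipBit : (w : Vec ℚ n) (x : Vec Bool n) (j : Fin n) → dot w (flipBit j x) ≡ dot w x +ℚ shift w x j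
dot-flipBit (a ∷ w) (true  ∷ x) zero    = solve 2 (λ a d → con 0ℚ :+ d := (a :+ d) :+ :- a) refl a (dot w x)
  where open +-*-Solver
dot-flipBit (a ∷ w) (false ∷ x) zero    = solve 2 (λ a d → a :+ d := (con 0ℚ :+ d) :+ a) refl a (dot w x)
  where open +-*-Solver
dot-flipBit (a ∷ w) (b     ∷ x) (suc j) =
  trans (cong ((if b then a else 0ℚ) +ℚ_) (dot-flipBit w x j)) (sym (ℚ.+-assoc (if b then a else 0ℚ) (dot w x) (shift w x j)))

∣shift∣ : (w : Vec ℚ n) (x : Vec Bool n) (j : Fin n) → ∣ shift w x j ∣ ≡ ∣ lookup w j ∣
∣shift∣ w x j with lookup x j
... | true  = ℚ.∣-p∣≡∣p∣ (lookup w j)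
... | false = refl

shift-flipBit-≢ : (w : Vec ℚ n) (x : Vec Bool n) {i j : Fin n} → j ≢ i → shift w (flipBit i x) j ≡ shift w x j
shift-flipBit-≢ w x {i} {j} j≢i =
  cong (λ b → if b then - lookup w j else lookup w j) (lookup∘updateAt′ j i j≢i x)

p≤∣p∣ : ∀ p → p ≤ℚ ∣ p ∣
p≤∣p∣ (mkℚ (ℤ.+ _) _ _)    = ℚ.≤-refl
p≤∣p∣ p@(mkℚ ℤ.-[1+ _ ] _ _) = ℚ.≤-trans (ℚ.<⇒≤ (ℚ.negative⁻¹ p)) (ℚ.0≤∣p∣ p)

≤∣q∣⇒≤q⊎p+q≤0 : ∀ {p q} → p ≤ℚ ∣ q ∣ → p ≤ℚ q ⊎ p +ℚ q ≤ℚ 0ℚ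
≤∣q∣⇒≤q⊎p+q≤0 {p} {q} p≤∣q∣ with ℚ.∣p∣≡p∨∣p∣≡-p q
... | inj₁ ∣q∣≡q  = inj₁ (subst (p ≤ℚ_) ∣q∣≡q p≤∣q∣)
... | inj₂ ∣q∣≡-q = inj₂ (begin
  p +ℚ q    ≤⟨ ℚ.+-monoˡ-≤ q (subst (p ≤ℚ_) ∣q∣≡-q p≤∣q∣) ⟩
  - q +ℚ q  ≡⟨ ℚ.+-inverseˡ q ⟩
  0ℚ        ∎)
  where open ℚ.≤-Reasoning

ThresholdRep : BoolFun n → Vec ℚ n → ℚ → Set
ThresholdRep f w θ = ∀ x → (f x ≡ true → θ <ℚ dot w x) × (θ <ℚ dot w x → f x ≡ true)

true≢false : ∀ {a b : Bool} → a ≡ true → b ≡ false → a ≢ b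
true≢false refl refl ()

≢⇒false-true⊎true-false : ∀ {a b : Bool} → a ≢ b → (a ≡ false × b ≡ true) ⊎ (a ≡ true × b ≡ false)
≢⇒false-true⊎true-false {false} {true}  _  = inj₁ (refl , refl)
≢⇒false-true⊎true-false {true}  {false} _  = inj₂ (refl , refl)
≢⇒false-true⊎true-false {false} {false} a≢b = contradiction refl a≢b
≢⇒false-true⊎true-false {true}  {true}  a≢b = contradiction refl a≢b

module _ {f : BoolFun n} {w : Vec ℚ n} {θ : ℚ} (rep : ThresholdRep f w θ) where

  true-upward : ∀ {x y} → dot w x ≤ℚ dot w y → f x ≡ true → f y ≡ true
  true-upward {x} {y} x≤y fx = proj₂ (rep y) (ℚ.<-≤-trans (proj₁ (rep x) fx) x≤y)

  false-downward : ∀ {x y} → dot w y ≤ℚ dot w x → f x ≡ false → f y ≡ false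
  false-downward {x} {y} y≤x fx with f y in fy
  ... | true  = contradiction (true-upward y≤x fy) (λ fx≡true → true≢false fx≡true fx refl)
  ... | false = refl

  flip-up : ∀ {x i j} → f (flipBit i x) ≡ true → shift w x i ≤ℚ shift w x j → f (flipBit j x) ≡ true
  flip-up {x} {i} {j} fx′ Dᵢ≤Dⱼ = true-upward (begin
    dot w (flipBit i x)      ≡⟨ dot-flipBit w x i ⟩
    dot w x +ℚ shift w x i   ≤⟨ ℚ.+-monoʳ-≤ (dot w x) Dᵢ≤Dⱼ ⟩
    dot w x +ℚ shift w x j   ≡⟨ dot-flipBit w x j ⟨
    dot w (flipBit j x)      ∎) fx′
    where open ℚ.≤-Reasoning

  flip-down : ∀ {x i j} → j ≢ i → f x ≡ false → shift w x i +ℚ shift w x j ≤ℚ 0ℚ →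
              f (flipBit j (flipBit i x)) ≡ false
  flip-down {x} {i} {j} j≢i fx Dᵢ+Dⱼ≤0 = false-downward (begin
    dot w (flipBit j (flipBit i x))                  ≡⟨ dot-flipBit w (flipBit i x) j ⟩
    dot w (flipBit i x) +ℚ shift w (flipBit i x) j   ≡⟨ cong₂ _+ℚ_ (dot-flipBit w x i) (shift-flipBit-≢ w x j≢i) ⟩
    (dot w x +ℚ shift w x i) +ℚ shift w x j          ≡⟨ ℚ.+-assoc (dot w x) _ _ ⟩
    dot w x +ℚ (shift w x i +ℚ shift w x j)          ≤⟨ ℚ.+-monoʳ-≤ (dot w x) Dᵢ+Dⱼ≤0 ⟩
    dot w x +ℚ 0ℚ                                    ≡⟨ ℚ.+-identityʳ (dot w x) ⟩
    dot w x                                          ∎) fx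
    where open ℚ.≤-Reasoning

  minimal-edge-covers : {i : Fin n} → (∀ j → ∣ lookup w i ∣ ≤ℚ ∣ lookup w j ∣) →
                        {x : Vec Bool n} → f x ≡ false → f (flipBit i x) ≡ true → ∀ j →
                        f x ≢ f (flipBit j x) ⊎ f (flipBit i x) ≢ f (flipBit j (flipBit i x))
  minimal-edge-covers {i} minimal {x} fx fx′ j with j ≟ i
  ... | yes refl = inj₁ (≢-sym (true≢false fx′ fx))
  ... | no j≢i with ≤∣q∣⇒≤q⊎p+q≤0 Dᵢ≤∣Dⱼ∣
    where
    Dᵢ≤∣Dⱼ∣ : shift w x i ≤ℚ ∣ shift w x j ∣
    Dᵢ≤∣Dⱼ∣ = ℚ.≤-trans (p≤∣p∣ _) (subst₂ _≤ℚ_ (sym (∣shift∣ w x i)) (sym (∣shift∣ w x j)) (minimal j))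
  ...   | inj₁ Dᵢ≤Dⱼ   = inj₁ (≢-sym (true≢false (flip-up fx′ Dᵢ≤Dⱼ) fx))
  ...   | inj₂ Dᵢ+Dⱼ≤0 = inj₂ (true≢false fx′ (flip-down j≢i fx Dᵢ+Dⱼ≤0))

  false-true-edge-sensitivity : {i : Fin n} → (∀ j → ∣ lookup w i ∣ ≤ℚ ∣ lookup w j ∣) →
                                {x : Vec Bool n} → f x ≡ false → f (flipBit i x) ≡ true →
                                suc n ≤ sensAt f x + sensAt f (flipBit i x)
  false-true-edge-sensitivity {i} minimal {x} fx fx′ = begin
    suc n                                                 ≤⟨ n<∑ (λ j → s j + s′ j) i covered doubly-covered ⟩
    ∑[ j < n ] (s j + s′ j)                               ≡⟨ ∑-distrib-+ s s′ ⟩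
    sum s + sum s′                                        ≡⟨ cong₂ _+_ (sensAt≡∑sensitiveAt f x) (sensAt≡∑sensitiveAt f x′) ⟨
    sensAt f x + sensAt f x′                              ∎
    where
    open ℕ.≤-Reasoning
    x′ = flipBit i x
    s  = sensitiveAt f x
    s′ = sensitiveAt f x′
    covered : ∀ j → 1 ≤ s j + s′ j
    covered j with minimal-edge-covers minimal fx fx′ j
    ... | inj₁ x-sensitive  = ℕ.≤-trans (1≤sensitiveAt f x-sensitive) (ℕ.m≤m+n _ _)
    ... | inj₂ x′-sensitive = ℕ.≤-trans (1≤sensitiveAt f x′-sensitive) (ℕ.m≤n+m _ _)
    doubly-covered : 2 ≤ s i + s′ i
    doubly-covered = ℕ.+-mono-≤ (1≤sensitiveAt f (≢-sym (true≢false fx′ fx)))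
      (1≤sensitiveAt f (subst (f x′ ≢_) (cong f (sym (flipBit-involutive i x))) (true≢false fx′ fx)))

  minimal-edge-sensitivity : {i : Fin n} → (∀ j → ∣ lookup w i ∣ ≤ℚ ∣ lookup w j ∣) →
                             {x : Vec Bool n} → f x ≢ f (flipBit i x) →
                             suc n ≤ sensAt f x + sensAt f (flipBit i x)
  minimal-edge-sensitivity {i} minimal {x} differs with ≢⇒false-true⊎true-false differs
  ... | inj₁ (fx , fx′) = false-true-edge-sensitivity minimal fx fx′
  ... | inj₂ (fx , fx′) = begin
    suc n                                              ≤⟨ false-true-edge-sensitivity minimal fx′ fx″ ⟩
    sensAt f x′ + sensAt f (flipBit i x′)              ≡⟨ cong (λ y → sensAt f x′ + sensAt f y) (flipBit-involutive i x) ⟩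
    sensAt f x′ + sensAt f x                           ≡⟨ ℕ.+-comm (sensAt f x′) (sensAt f x) ⟩
    sensAt f x + sensAt f x′                           ∎
    where
    open ℕ.≤-Reasoning
    x′ = flipBit i x
    fx″ : f (flipBit i x′) ≡ true
    fx″ = trans (cong f (flipBit-involutive i x)) fx

sensitivity-ltf-≥ : (f : BoolFun (suc n)) → IsLTF f → DependsOnAll f → ⌈ suc (suc n) /2⌉ ≤ sensitivity f
sensitivity-ltf-≥ {n} f (w , θ , rep) depends =
  ⌈/2⌉≤sensitivity f x (flipBit i x) (minimal-edge-sensitivity {w = w} rep minimal differs)
  where
  i = argmin (λ j → ∣ lookup w j ∣) zero (allFin (suc n))
  minimal : ∀ j → ∣ lookup w i ∣ ≤ℚ ∣ lookup w j ∣
  minimal j = All.lookup (f[argmin]≤f[xs] {f = λ j → ∣ lookup w j ∣} zero (allFin (suc n))) (∈-allFin j)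
  x = proj₁ (depends i)
  differs = proj₂ (depends i)

IsLTF-cong : {f g : BoolFun n} → (∀ x → f x ≡ g x) → IsLTF f → IsLTF g
IsLTF-cong f≗g (w , θ , rep) = w , θ , λ x →
  (λ gx → proj₁ (rep x) (trans (f≗g x) gx)) , (λ θ<wx → trans (sym (f≗g x)) (proj₂ (rep x) θ<wx))

DependsOnAll-cong : {f g : BoolFun n} → (∀ x → f x ≡ g x) → DependsOnAll f → DependsOnAll g
DependsOnAll-cong f≗g depends i with depends i
... | x , differs = x , λ gx≡gx′ → differs (trans (f≗g x) (trans gx≡gx′ (sym (f≗g _))))

toℚ : ℕ → ℚ
toℚ zero    = 0ℚ
toℚ (suc k) = 1ℚ +ℚ toℚ k

toℚ-mono-≤ : ∀ {a b} → a ≤ b → toℚ a ≤ℚ toℚ b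
toℚ-mono-≤ {zero}  {zero}  z≤n       = ℚ.≤-refl
toℚ-mono-≤ {zero}  {suc b} z≤n       =
  subst (_≤ℚ 1ℚ +ℚ toℚ b) (ℚ.+-identityˡ 0ℚ) (ℚ.+-mono-≤ (ℚ.nonNegative⁻¹ 1ℚ) (toℚ-mono-≤ {zero} {b} z≤n))
toℚ-mono-≤ (s≤s a≤b) = ℚ.+-monoʳ-≤ 1ℚ (toℚ-mono-≤ a≤b)

toℚ-mono-< : ∀ {a b} → a < b → toℚ a <ℚ toℚ b
toℚ-mono-< {a} a<b = ℚ.<-≤-trans a<1+a (toℚ-mono-≤ a<b)
  where
  a<1+a : toℚ a <ℚ 1ℚ +ℚ toℚ a
  a<1+a = subst (_<ℚ 1ℚ +ℚ toℚ a) (ℚ.+-identityˡ (toℚ a)) (ℚ.+-monoˡ-< (toℚ a) (ℚ.positive⁻¹ 1ℚ))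

toℚ-cancel-< : ∀ {a b} → toℚ a <ℚ toℚ b → a < b
toℚ-cancel-< {a} {b} a<b with a ℕ.<? b
... | yes a<b′ = a<b′
... | no  a≮b  = contradiction (ℚ.<-≤-trans a<b (toℚ-mono-≤ (ℕ.≮⇒≥ a≮b))) (ℚ.<-irrefl refl)

dot-ones : (x : Vec Bool n) → dot (replicate n 1ℚ) x ≡ toℚ (weight x)
dot-ones []          = refl
dot-ones (true  ∷ x) = cong (1ℚ +ℚ_) (dot-ones x)
dot-ones (false ∷ x) = trans (ℚ.+-identityˡ _) (dot-ones x)

weightExceeds : ℕ → BoolFun n
weightExceeds k x = k <ᵇ weight x

weightExceeds-isLTF : (k : ℕ) → IsLTF (weightExceeds {n} k)
weightExceeds-isLTF {n} k = replicate n 1ℚ , toℚ k , λ x →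
  (λ fx → subst (toℚ k <ℚ_) (sym (dot-ones x)) (toℚ-mono-< (ℕ.<ᵇ⇒< k (weight x) (Equivalence.from T-≡ fx)))) ,
  (λ k<wx → Equivalence.to T-≡ (ℕ.<⇒<ᵇ (toℚ-cancel-< {k} {weight x} (subst (toℚ k <ℚ_) (dot-ones x) k<wx))))

<ᵇ-self≢<ᵇ-suc : ∀ k → (k <ᵇ k) ≢ (k <ᵇ suc k)
<ᵇ-self≢<ᵇ-suc zero    ()
<ᵇ-self≢<ᵇ-suc (suc k) = <ᵇ-self≢<ᵇ-suc k

<ᵇ-suc≢<ᵇ⇒≡ : ∀ k m → (k <ᵇ suc m) ≢ (k <ᵇ m) → k ≡ m
<ᵇ-suc≢<ᵇ⇒≡ zero    zero    _  = refl
<ᵇ-suc≢<ᵇ⇒≡ zero    (suc m) ne = contradiction refl ne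
<ᵇ-suc≢<ᵇ⇒≡ (suc k) zero    ne = contradiction refl ne
<ᵇ-suc≢<ᵇ⇒≡ (suc k) (suc m) ne = cong suc (<ᵇ-suc≢<ᵇ⇒≡ k m ne)

weight-flipBit-one : (x : Vec Bool n) (j : Fin n) → lookup x j ≡ true → weight x ≡ suc (weight (flipBit j x))
weight-flipBit-one (true  ∷ x) zero    refl = refl
weight-flipBit-one (true  ∷ x) (suc j) xⱼ   = cong suc (weight-flipBit-one x j xⱼ)
weight-flipBit-one (false ∷ x) (suc j) xⱼ   = weight-flipBit-one x j xⱼ

weight-flipBit-zero : (x : Vec Bool n) (j : Fin n) → lookup x j ≡ false → weight (flipBit j x) ≡ suc (weight x)
weight-flipBit-zero (false ∷ x) zero    refl = refl
weight-flipBit-zero (true  ∷ x) (suc j) xⱼ   = cong suc (weight-flipBit-zero x j xⱼ)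
weight-flipBit-zero (false ∷ x) (suc j) xⱼ   = weight-flipBit-zero x j xⱼ

weightExceeds-sensitive-one : (k : ℕ) (x : Vec Bool n) (j : Fin n) → lookup x j ≡ true →
                              weightExceeds k x ≢ weightExceeds k (flipBit j x) → weight x ≡ suc k
weightExceeds-sensitive-one k x j xⱼ differs = trans w≡1+w′ (cong suc (sym k≡w′))
  where
  w≡1+w′ = weight-flipBit-one x j xⱼ
  k≡w′ = <ᵇ-suc≢<ᵇ⇒≡ k _ (subst (λ w → (k <ᵇ w) ≢ weightExceeds k (flipBit j x)) w≡1+w′ differs)

weightExceeds-sensitive-zero : (k : ℕ) (x : Vec Bool n) (j : Fin n) → lookup x j ≡ false →
                               weightExceeds k x ≢ weightExceeds k (flipBit j x) → weight x ≡ k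
weightExceeds-sensitive-zero k x j xⱼ differs =
  sym (<ᵇ-suc≢<ᵇ⇒≡ k _ (≢-sym (subst (λ w → weightExceeds k x ≢ (k <ᵇ w)) (weight-flipBit-zero x j xⱼ) differs)))

sensAt-weightExceeds-≤-ones : (k : ℕ) (x : Vec Bool n) → weight x ≢ k → sensAt (weightExceeds k) x ≤ weight x
sensAt-weightExceeds-≤-ones {n} k x w≢k = begin
  sensAt (weightExceeds k) x                ≡⟨ sensAt≡∑sensitiveAt (weightExceeds k) x ⟩
  sum (sensitiveAt (weightExceeds k) x)     ≤⟨ ∑-mono-≤ (λ j → sensitiveAt≤if (weightExceeds k) {x} {j} (lookup x j) (at-one j)) ⟩
  ∑[ j < n ] (if lookup x j then 1 else 0)  ≡⟨ ∑-ones x ⟩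
  weight x                                  ∎
  where
  open ℕ.≤-Reasoning
  at-one : ∀ j → weightExceeds k x ≢ weightExceeds k (flipBit j x) → lookup x j ≡ true
  at-one j differs with lookup x j in xⱼ
  ... | true  = refl
  ... | false = contradiction (weightExceeds-sensitive-zero k x j xⱼ differs) w≢k

sensAt-weightExceeds-≤-zeros : (k : ℕ) (x : Vec Bool n) → weight x ≢ suc k → sensAt (weightExceeds k) x ≤ n ∸ weight x
sensAt-weightExceeds-≤-zeros {n} k x w≢1+k = begin
  sensAt (weightExceeds k) x                      ≡⟨ sensAt≡∑sensitiveAt (weightExceeds k) x ⟩
  sum (sensitiveAt (weightExceeds k) x)           ≤⟨ ∑-mono-≤ (λ j → sensitiveAt≤if (weightExceeds k) {x} {j} (not (lookup x j)) (at-zero j)) ⟩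
  ∑[ j < n ] (if not (lookup x j) then 1 else 0)  ≡⟨ ∑-zeros x ⟩
  n ∸ weight x                                    ∎
  where
  open ℕ.≤-Reasoning
  at-zero : ∀ j → weightExceeds k x ≢ weightExceeds k (flipBit j x) → not (lookup x j) ≡ true
  at-zero j differs with lookup x j in xⱼ
  ... | true  = contradiction (weightExceeds-sensitive-one k x j xⱼ differs) w≢1+k
  ... | false = refl

sensAt-weightExceeds : (k : ℕ) (x : Vec Bool n) → sensAt (weightExceeds k) x ≤ suc k ⊔ (n ∸ k)
sensAt-weightExceeds {n} k x with weight x ℕ.≟ suc k
... | yes w≡1+k = ℕ.≤-trans (sensAt-weightExceeds-≤-ones k x w≢k) (ℕ.≤-trans (ℕ.≤-reflexive w≡1+k) (ℕ.m≤m⊔n (suc k) (n ∸ k)))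
  where
  w≢k : weight x ≢ k
  w≢k w≡k = ℕ.1+n≢n (trans (sym w≡1+k) w≡k)
... | no w≢1+k with k ℕ.≤? weight x
...   | yes k≤w = ℕ.≤-trans (sensAt-weightExceeds-≤-zeros k x w≢1+k) (ℕ.≤-trans (ℕ.∸-monoʳ-≤ n k≤w) (ℕ.m≤n⊔m (suc k) (n ∸ k)))
...   | no  k≰w = ℕ.≤-trans (sensAt-weightExceeds-≤-ones k x (ℕ.<⇒≢ w<k)) (ℕ.≤-trans (ℕ.<⇒≤ (ℕ.m<n⇒m<1+n w<k)) (ℕ.m≤m⊔n (suc k) (n ∸ k)))
  where
  w<k : weight x < k
  w<k = ℕ.≰⇒> k≰w

weight-replicate-false : ∀ m → weight (replicate m false) ≡ 0
weight-replicate-false zero    = refl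
weight-replicate-false (suc m) = weight-replicate-false m

withWeight : ∀ {k m} → k ≤ m → Vec Bool m
withWeight {m = m} z≤n = replicate m false
withWeight (s≤s k≤m)   = true ∷ withWeight k≤m

weight-withWeight : ∀ {k m} (k≤m : k ≤ m) → weight (withWeight k≤m) ≡ k
weight-withWeight {m = m} z≤n = weight-replicate-false m
weight-withWeight (s≤s k≤m)   = cong suc (weight-withWeight k≤m)

weight-insertAt-false : (v : Vec Bool n) (i : Fin (suc n)) → weight (insertAt v i false) ≡ weight v
weight-insertAt-false v           zero    = refl
weight-insertAt-false (true  ∷ v) (suc i) = cong suc (weight-insertAt-false v i)
weight-insertAt-false (false ∷ v) (suc i) = weight-insertAt-false v i

weightExceeds-dependsOnAll : ∀ {m k} → k ≤ m → DependsOnAll (weightExceeds {suc m} k)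
weightExceeds-dependsOnAll {m} {k} k≤m i = x , differs
  where
  x = insertAt (withWeight k≤m) i false
  w≡k : weight x ≡ k
  w≡k = trans (weight-insertAt-false (withWeight k≤m) i) (weight-withWeight k≤m)
  w′≡1+k : weight (flipBit i x) ≡ suc k
  w′≡1+k = trans (weight-flipBit-zero x i (insertAt-lookup (withWeight k≤m) i false)) (cong suc w≡k)
  differs : weightExceeds k x ≢ weightExceeds k (flipBit i x)
  differs = subst₂ (λ a b → (k <ᵇ a) ≢ (k <ᵇ b)) (sym w≡k) (sym w′≡1+k) (<ᵇ-self≢<ᵇ-suc k)

<ᵇ-double : ∀ m w → (m <ᵇ w + w) ≡ (⌊ m /2⌋ <ᵇ w)
<ᵇ-double m             zero    = refl
<ᵇ-double zero          (suc w) = refl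
<ᵇ-double (suc zero)    (suc w) rewrite ℕ.+-suc w w = refl
<ᵇ-double (suc (suc m)) (suc w) rewrite ℕ.+-suc w w = <ᵇ-double m w

majority≗weightExceeds : (m : ℕ) (x : Vec Bool m) → majority m x ≡ weightExceeds ⌊ m /2⌋ x
majority≗weightExceeds m x =
  trans (cong (λ w → m <ᵇ weight x + w) (ℕ.+-identityʳ (weight x))) (<ᵇ-double m (weight x))

majority-isLTF : (m : ℕ) → IsLTF (majority m)
majority-isLTF m = IsLTF-cong (sym ∘ majority≗weightExceeds m) (weightExceeds-isLTF ⌊ m /2⌋)

majority-dependsOnAll : (m : ℕ) → DependsOnAll (majority (suc m))
majority-dependsOnAll m =
  DependsOnAll-cong (sym ∘ majority≗weightExceeds (suc m)) (weightExceeds-dependsOnAll (s≤s⁻¹ (ℕ.⌊n/2⌋<n m)))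

sensitivity-majority-≤ : (m : ℕ) → sensitivity (majority m) ≤ ⌈ suc m /2⌉
sensitivity-majority-≤ m = sensitivity≤ (majority m) λ x → begin
  sensAt (majority m) x          ≡⟨ sensAt-cong (majority≗weightExceeds m) x ⟩
  sensAt (weightExceeds K) x     ≤⟨ sensAt-weightExceeds K x ⟩
  suc K ⊔ (m ∸ K)                ≤⟨ ℕ.⊔-lub ℕ.≤-refl m∸K≤1+K ⟩
  suc K                          ∎
  where
  open ℕ.≤-Reasoning
  K = ⌊ m /2⌋
  m∸K≤1+K : m ∸ K ≤ suc K
  m∸K≤1+K = subst (_≤ suc K) (trans (sym (ℕ.m+n∸m≡n K ⌈ m /2⌉)) (cong (_∸ K) (ℕ.⌊n/2⌋+⌈n/2⌉≡n m)))
                  (ℕ.⌈n/2⌉-mono (ℕ.n≤1+n m))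

lemma4 : ((n : ℕ) → 1 ≤ n → (f : Vec Bool n → Bool) → IsLTF f → DependsOnAll f →
           ⌈ suc n /2⌉ ≤ sensitivity f)
         × ((n : ℕ) → 1 ≤ n →
           IsLTF (majority n) × DependsOnAll (majority n) × (sensitivity (majority n) ≡ ⌈ suc n /2⌉))
lemma4 = ltf-bound , majority-optimal
  where
  ltf-bound : (n : ℕ) → 1 ≤ n → (f : Vec Bool n → Bool) → IsLTF f → DependsOnAll f → ⌈ suc n /2⌉ ≤ sensitivity f
  ltf-bound (suc m) _ = sensitivity-ltf-≥
  majority-optimal : (n : ℕ) → 1 ≤ n →
                     IsLTF (majority n) × DependsOnAll (majority n) × (sensitivity (majority n) ≡ ⌈ suc n /2⌉)
  majority-optimal (suc m) 1≤n = majority-isLTF (suc m) , majority-dependsOnAll m ,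
    ℕ.≤-antisym (sensitivity-majority-≤ (suc m))
                (ltf-bound (suc m) 1≤n (majority (suc m)) (majority-isLTF (suc m)) (majority-dependsOnAll m))
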